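{- Let $n,m,\Delta\in\mathbb{N}$ and $f:[n]\to[\Delta]$, and let $D=\sum_{i\in[n]}f(i)$. Suppose $H$ is a bipartite graph with vertex classes $A$ and $B$, where $A$ is a copy of $[n]$ and $B$ is a set of size $D$, such that: (i) every $U\subset A$ with $|U|\le m$ satisfies $|N(U)|\ge \Delta|U|$; (ii) every $U\subset B$ with $|U|\le m$ satisfies $|N(U)|\ge |U|$; (iii) for every $U\subset A$ and $V\subset B$ with $|U|,|V|\ge m$, there is an edge of $H$ between $U$ and $V$. Then there is an $f$-matching from $A$ into $B$.
   Context: $[n]=\{1,\dots,n\}$. In a bipartite graph with classes $A,B$ and a function $f:A\to\mathbb{N}$, an $f$-matching from $A$ into $B$ is a collection of pairwise disjoint sets $\{X_a\subset N(a): a\in A\}$ with $|X_a|=f(a)$ for each $a\in A$. $N(U)$ denotes the set of vertices adjacent to some vertex of $U$ (here in the other class). -}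

module Defs where

open import Data.Nat using (ℕ; zero; suc; _+_; _*_; _≤_)
open import Data.Bool using (Bool; true; false; T; _∧_; _∨_)
open import Data.Fin using (Fin; zero; suc)
open import Data.Fin.Subset using (Subset; _∈_; ∣_∣)
open import Data.Vec using (tabulate; lookup)
open import Data.Product using (_×_)
open import Relation.Nullary using (¬_)
open import Data.Empty using (⊥)
open import Relation.Binary.PropositionalEquality using (_≡_)

sumF : (n : ℕ) → (Fin n → ℕ) → ℕ
sumF zero    f = zero
sumF (suc n) f = f zero + sumF n (λ i → f (suc i))

anyB : (k : ℕ) → (Fin k → Bool) → Bool
anyB zero    p = false
anyB (suc k) p = p zero ∨ anyB k (λ i → p (suc i))

BipGraph : ℕ → ℕ → Set
BipGraph a b = Fin a → Fin b → Bool

Adj : ∀ {a b} → BipGraph a b → Fin a → Fin b → Set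
Adj H x y = T (H x y)

NA : ∀ {a b} → BipGraph a b → Subset a → Subset b
NA H U = tabulate (λ y → anyB _ (λ x → lookup U x ∧ H x y))

NB : ∀ {a b} → BipGraph a b → Subset b → Subset a
NB H V = tabulate (λ x → anyB _ (λ y → lookup V y ∧ H x y))

record FMatching {a b} (H : BipGraph a b) (f : Fin a → ℕ) : Set where
  field
    X        : Fin a → Subset b
    inNbhd   : ∀ x y → y ∈ X x → Adj H x y
    size     : ∀ x → ∣ X x ∣ ≡ f x
    disjoint : ∀ x x′ y → ¬ (x ≡ x′) → y ∈ X x → y ∈ X x′ → ⊥

-- Conditions (i)–(iii) give the weighted Hall condition f(S) ≤ |N(S)| for every S ⊆ A.
-- If |S| ≤ m this is (i), as f ≤ Δ. If |S| ≥ m, the set V = B ∖ N(S) sends no edge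
-- to S, so |V| < m by (iii), and then (ii) and f ≥ 1 give |V| ≤ |N(V)| ≤ |A ∖ S| ≤ f(A ∖ S);
-- since |B| = f(A), complementing yields f(S) ≤ |N(S)|.
-- Hall's theorem for f-matchings then follows by induction on f(A): if some S with
-- 0 < f(S) < f(A) is critical (|N(S)| ≤ f(S)), match S into N(S) and A ∖ S into
-- B ∖ N(S) separately; otherwise every such S has a neighbour to spare, so any edge
-- xy can be put into the matching, deleting y and lowering f(x) by one.

module Submission where

open import Defs
open import Algebra.Bundles using (CommutativeMonoid)
open import Data.Bool using (Bool; true; false; T; T?; not; _∧_; _∨_; if_then_else_)
open import Data.Bool.Properties using (T-∧; T-∨; T-≡; ∧-assoc; ∧-distribʳ-∨; ∨-commutativeMonoid)
open import Data.Empty using (⊥; ⊥-elim)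
open import Data.Fin using (Fin; zero; suc; _≟_)
open import Data.Fin.Properties using (any?)
open import Data.Fin.Subset using (Subset; _∈_; ∣_∣)
open import Data.Fin.Subset.Properties using (anySubset?)
open import Data.Nat using (ℕ; zero; suc; _+_; _*_; _∸_; _≤_; _<_; z≤n; _≤?_; _<?_)
open import Data.Nat.Properties renaming (_≟_ to _≟ℕ_)
open import Data.Product using (_×_; _,_; proj₁; proj₂; ∃; ∃₂)
open import Data.Sum using (_⊎_; inj₁; inj₂)
open import Data.Unit using (tt)
open import Data.Vec using ([]; _∷_; tabulate; lookup)
open import Data.Vec.Properties using (lookup∘tabulate; []=⇒lookup)
open import Function using (_∘_; id; flip)
open import Function.Bundles using (module Equivalence)
open import Relation.Binary.PropositionalEquality
open import Relation.Nullary using (¬_; yes; no; does; contradiction)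
open import Relation.Nullary.Decidable using (_×-dec_)
open import Relation.Unary using () renaming (Decidable to Decidable₁)

open import Algebra.Properties.CommutativeSemigroup +-commutativeSemigroup
  using () renaming (interchange to +-interchange)
open import Algebra.Properties.CommutativeSemigroup
  (CommutativeMonoid.commutativeSemigroup ∨-commutativeMonoid)
  using () renaming (interchange to ∨-interchange)
open Equivalence using (to; from)

private
  variable
    k n b : ℕ

T-not⇒¬T : ∀ {a} → T (not a) → ¬ T a
T-not⇒¬T {false} _ ()

¬T⇒T-not : ∀ {a} → ¬ T a → T (not a)
¬T⇒T-not {false} _ = tt
¬T⇒T-not {true}  ¬a = ¬a tt

sumF-cong : {g h : Fin k → ℕ} → g ≗ h → sumF k g ≡ sumF k h
sumF-cong {zero}  g≗h = refl
sumF-cong {suc k} g≗h = cong₂ _+_ (g≗h zero) (sumF-cong (g≗h ∘ suc))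

sumF-mono : {g h : Fin k → ℕ} → (∀ i → g i ≤ h i) → sumF k g ≤ sumF k h
sumF-mono {zero}  g≤h = z≤n
sumF-mono {suc k} g≤h = +-mono-≤ (g≤h zero) (sumF-mono (g≤h ∘ suc))

sumF-+ : (g h : Fin k → ℕ) → sumF k (λ i → g i + h i) ≡ sumF k g + sumF k h
sumF-+ {zero}  g h = refl
sumF-+ {suc k} g h = trans (cong (g zero + h zero +_) (sumF-+ (g ∘ suc) (h ∘ suc)))
                           (+-interchange (g zero) (h zero) _ _)

sumF-*ˡ : ∀ c (g : Fin k → ℕ) → sumF k (λ i → c * g i) ≡ c * sumF k g
sumF-*ˡ {zero}  c g = sym (*-zeroʳ c)
sumF-*ˡ {suc k} c g = trans (cong (c * g zero +_) (sumF-*ˡ c (g ∘ suc)))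
                            (sym (*-distribˡ-+ c (g zero) _))

sumF-zero : {g : Fin k → ℕ} → (∀ i → g i ≡ 0) → sumF k g ≡ 0
sumF-zero {zero}  g≡0 = refl
sumF-zero {suc k} g≡0 = cong₂ _+_ (g≡0 zero) (sumF-zero (g≡0 ∘ suc))

sumF-one : sumF k (λ _ → 1) ≡ k
sumF-one {zero}  = refl
sumF-one {suc k} = cong suc sumF-one

≤-sumF : (g : Fin k → ℕ) (i : Fin k) → g i ≤ sumF k g
≤-sumF g zero    = m≤m+n (g zero) _
≤-sumF g (suc i) = ≤-trans (≤-sumF (g ∘ suc) i) (m≤n+m _ (g zero))

anyB-intro : (p : Fin k → Bool) (i : Fin k) → T (p i) → T (anyB k p)
anyB-intro p zero    t = from T-∨ (inj₁ t)
anyB-intro p (suc i) t = from T-∨ (inj₂ (anyB-intro (p ∘ suc) i t))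

anyB-elim : (p : Fin k → Bool) → T (anyB k p) → ∃ λ i → T (p i)
anyB-elim {suc k} p t with to T-∨ t
... | inj₁ t₀ = zero , t₀
... | inj₂ t₁ with anyB-elim (p ∘ suc) t₁
...   | i , tᵢ = suc i , tᵢ

anyB-cong : {p q : Fin k → Bool} → p ≗ q → anyB k p ≡ anyB k q
anyB-cong {zero}  p≗q = refl
anyB-cong {suc k} p≗q = cong₂ _∨_ (p≗q zero) (anyB-cong (p≗q ∘ suc))

anyB-∨ : (p q : Fin k → Bool) → anyB k (λ i → p i ∨ q i) ≡ anyB k p ∨ anyB k q
anyB-∨ {zero}  p q = refl
anyB-∨ {suc k} p q = trans (cong ((p zero ∨ q zero) ∨_) (anyB-∨ (p ∘ suc) (q ∘ suc)))
                           (∨-interchange (p zero) (q zero) _ _)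

anyB-∧ʳ : (p : Fin k → Bool) (c : Bool) → anyB k (λ i → p i ∧ c) ≡ anyB k p ∧ c
anyB-∧ʳ {zero}  p c = refl
anyB-∧ʳ {suc k} p c = trans (cong ((p zero ∧ c) ∨_) (anyB-∧ʳ (p ∘ suc) c))
                            (sym (∧-distribʳ-∨ c (p zero) _))

Subsetᶠ : ℕ → Set
Subsetᶠ k = Fin k → Bool

∁ : Subsetᶠ k → Subsetᶠ k
∁ S i = not (S i)

_∩_ : Subsetᶠ k → Subsetᶠ k → Subsetᶠ k
(S ∩ R) i = S i ∧ R i

_∪_ : Subsetᶠ k → Subsetᶠ k → Subsetᶠ k
(S ∪ R) i = S i ∨ R i

⁅_⁆ : Fin k → Subsetᶠ k
⁅ i ⁆ j = does (j ≟ i)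

_⊆_ : Subsetᶠ k → Subsetᶠ k → Set
S ⊆ R = ∀ {i} → T (S i) → T (R i)

⁅⁆-sound : {i j : Fin k} → T (⁅ i ⁆ j) → j ≡ i
⁅⁆-sound {i = i} {j} t with j ≟ i
... | yes j≡i = j≡i

restrict : Subsetᶠ k → (Fin k → ℕ) → Fin k → ℕ
restrict S f i = if S i then f i else 0

weight : Subsetᶠ k → (Fin k → ℕ) → ℕ
weight {k} S f = sumF k (restrict S f)

card : Subsetᶠ k → ℕ
card S = weight S (λ _ → 1)

unit : Fin k → Fin k → ℕ
unit i = restrict ⁅ i ⁆ (λ _ → 1)

decrement : (Fin k → ℕ) → Fin k → Fin k → ℕ
decrement f i j = f j ∸ unit i j

restrict-comm : (S R : Subsetᶠ k) (f : Fin k → ℕ) → restrict S (restrict R f) ≗ restrict R (restrict S f)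
restrict-comm S R f i with S i | R i
... | true  | true  = refl
... | true  | false = refl
... | false | true  = refl
... | false | false = refl

weight-cong : {S R : Subsetᶠ k} (f : Fin k → ℕ) → S ≗ R → weight S f ≡ weight R f
weight-cong f S≗R = sumF-cong (λ i → cong (λ s → if s then f i else 0) (S≗R i))

card-mono : (S R : Subsetᶠ k) → S ⊆ R → card S ≤ card R
card-mono S R S⊆R = sumF-mono pointwise
  where
  pointwise : ∀ i → restrict S (λ _ → 1) i ≤ restrict R (λ _ → 1) i
  pointwise i with S i | R i | S⊆R {i}
  ... | false | _     | _   = z≤n
  ... | true  | true  | _   = ≤-refl
  ... | true  | false | S⊆R = ⊥-elim (S⊆R tt)

weight-monoʳ : (S : Subsetᶠ k) {f g : Fin k → ℕ} → (∀ i → f i ≤ g i) → weight S f ≤ weight S g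
weight-monoʳ S {f} {g} f≤g = sumF-mono pointwise
  where
  pointwise : ∀ i → restrict S f i ≤ restrict S g i
  pointwise i with S i
  ... | true  = f≤g i
  ... | false = z≤n

weight-+ : (S : Subsetᶠ k) (f g : Fin k → ℕ) → weight S (λ i → f i + g i) ≡ weight S f + weight S g
weight-+ S f g = trans (sumF-cong pointwise) (sumF-+ (restrict S f) (restrict S g))
  where
  pointwise : ∀ i → restrict S (λ i → f i + g i) i ≡ restrict S f i + restrict S g i
  pointwise i with S i
  ... | true  = refl
  ... | false = refl

weight-const : (S : Subsetᶠ k) (c : ℕ) → weight S (λ _ → c) ≡ c * card S
weight-const S c = trans (sumF-cong pointwise) (sumF-*ˡ c (restrict S (λ _ → 1)))
  where
  pointwise : ∀ i → restrict S (λ _ → c) i ≡ c * restrict S (λ _ → 1) i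
  pointwise i with S i
  ... | true  = sym (*-identityʳ c)
  ... | false = sym (*-zeroʳ c)

weight-restrict : (R S : Subsetᶠ k) (f : Fin k → ℕ) → weight R (restrict S f) ≡ weight (R ∩ S) f
weight-restrict R S f = sumF-cong pointwise
  where
  pointwise : ∀ i → restrict R (restrict S f) i ≡ restrict (R ∩ S) f i
  pointwise i with R i
  ... | true  = refl
  ... | false = refl

weight-∁ : (S : Subsetᶠ k) (f : Fin k → ℕ) → weight S f + weight (∁ S) f ≡ sumF k f
weight-∁ S f = trans (sym (sumF-+ (restrict S f) _)) (sumF-cong pointwise)
  where
  pointwise : ∀ i → restrict S f i + restrict (∁ S) f i ≡ f i
  pointwise i with S i
  ... | true  = +-identityʳ (f i)
  ... | false = refl

weight-∪ : (S R : Subsetᶠ k) (f : Fin k → ℕ) → weight (S ∪ R) f ≡ weight (S ∩ ∁ R) f + weight R f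
weight-∪ S R f = trans (sumF-cong pointwise) (sumF-+ (restrict (S ∩ ∁ R) f) _)
  where
  pointwise : ∀ i → restrict (S ∪ R) f i ≡ restrict (S ∩ ∁ R) f i + restrict R f i
  pointwise i with S i | R i
  ... | true  | true  = refl
  ... | true  | false = sym (+-identityʳ (f i))
  ... | false | _     = refl

card-∪-disjoint : (S R : Subsetᶠ k) → (∀ {i} → T (S i) → ¬ T (R i)) →
                  card (S ∪ R) ≡ card S + card R
card-∪-disjoint S R disjoint = trans (sumF-cong pointwise) (sumF-+ (restrict S (λ _ → 1)) _)
  where
  pointwise : ∀ i → restrict (S ∪ R) (λ _ → 1) i ≡ restrict S (λ _ → 1) i + restrict R (λ _ → 1) i
  pointwise i with S i | R i | disjoint {i}
  ... | true  | true  | disjoint = ⊥-elim (disjoint tt tt)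
  ... | true  | false | _        = refl
  ... | false | _     | _        = refl

weight-⁅⁆ : (i : Fin k) (f : Fin k → ℕ) → weight ⁅ i ⁆ f ≡ f i
weight-⁅⁆ {suc k} zero f = trans (cong (f zero +_) (sumF-zero {k} λ _ → refl)) (+-identityʳ (f zero))
weight-⁅⁆ {suc k} (suc i) f = weight-⁅⁆ i (f ∘ suc)

weight-unit : (R : Subsetᶠ k) (i : Fin k) → weight R (unit i) ≡ restrict R (λ _ → 1) i
weight-unit R i = trans (sumF-cong (restrict-comm R ⁅ i ⁆ _)) (weight-⁅⁆ i _)

card-∁ : (S : Subsetᶠ k) → card S + card (∁ S) ≡ k
card-∁ S = trans (weight-∁ S _) sumF-one

card-pos : {S : Subsetᶠ k} → 0 < card S → ∃ λ i → T (S i)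
card-pos {S = S} pos with any? (λ i → T? (S i))
... | yes found = found
... | no  none  = contradiction (sumF-zero outside) (n>0⇒n≢0 pos)
  where
  outside : ∀ i → restrict S (λ _ → 1) i ≡ 0
  outside i with S i | none ∘ (i ,_)
  ... | true  | ∉ = ⊥-elim (∉ tt)
  ... | false | _ = refl

unit≤ : {f : Fin k → ℕ} {i : Fin k} → 0 < f i → ∀ j → unit i j ≤ f j
unit≤ {i = i} pos j with j ≟ i
... | yes refl = pos
... | no  _    = z≤n

weight-decrement : {f : Fin k → ℕ} {i : Fin k} (R : Subsetᶠ k) → 0 < f i →
                   weight R f ≡ weight R (decrement f i) + (if R i then 1 else 0)
weight-decrement {f = f} {i} R pos = begin
  weight R f                                         ≡⟨ weight-cong′ ⟩
  weight R (λ j → decrement f i j + unit i j)        ≡⟨ weight-+ R (decrement f i) (unit i) ⟩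
  weight R (decrement f i) + weight R (unit i)       ≡⟨ cong (weight R (decrement f i) +_) (weight-unit R i) ⟩
  weight R (decrement f i) + restrict R (λ _ → 1) i  ∎
  where
  open ≡-Reasoning
  weight-cong′ : weight R f ≡ weight R (λ j → decrement f i j + unit i j)
  weight-cong′ = sumF-cong λ j → cong (λ x → if R j then x else 0) (sym (m∸n+n≡m (unit≤ pos j)))

weight<sumF : {S : Subsetᶠ k} (f : Fin k → ℕ) → 0 < weight (∁ S) f → weight S f < sumF k f
weight<sumF {S = S} f pos = subst (weight S f <_) (weight-∁ S f) (m<m+n _ pos)

weight-∁<sumF : {S : Subsetᶠ k} (f : Fin k → ℕ) → 0 < weight S f → weight (∁ S) f < sumF k f
weight-∁<sumF {S = S} f pos = subst (weight (∁ S) f <_) (weight-∁ S f) (m<n+m _ pos)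

N⁺ : BipGraph n b → Subsetᶠ n → Subsetᶠ b
N⁺ {n} H S y = anyB n (λ x → S x ∧ H x y)

_─_ : BipGraph n b → Subsetᶠ b → BipGraph n b
(H ─ Y) x y = H x y ∧ not (Y y)

N⁺-intro : (H : BipGraph n b) (S : Subsetᶠ n) {x : Fin n} {y : Fin b} →
           T (S x) → Adj H x y → T (N⁺ H S y)
N⁺-intro H S {x} Sx adj = anyB-intro _ x (from T-∧ (Sx , adj))

N⁺-elim : (H : BipGraph n b) (S : Subsetᶠ n) {y : Fin b} →
          T (N⁺ H S y) → ∃ λ x → T (S x) × Adj H x y
N⁺-elim H S t with anyB-elim _ t
... | x , Sx∧adj = x , to T-∧ Sx∧adj

N⁺-cong : (H : BipGraph n b) {S R : Subsetᶠ n} → S ≗ R → N⁺ H S ≗ N⁺ H R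
N⁺-cong H S≗R y = anyB-cong λ x → cong (_∧ H x y) (S≗R x)

N⁺-mono : (H : BipGraph n b) {S R : Subsetᶠ n} → S ⊆ R → N⁺ H S ⊆ N⁺ H R
N⁺-mono H {S} {R} S⊆R t with N⁺-elim H S t
... | x , Sx , adj = N⁺-intro H R (S⊆R Sx) adj

N⁺-∪ : (H : BipGraph n b) (S R : Subsetᶠ n) → N⁺ H (S ∪ R) ≗ N⁺ H S ∪ N⁺ H R
N⁺-∪ H S R y = trans (anyB-cong λ x → ∧-distribʳ-∨ (H x y) (S x) (R x))
                     (anyB-∨ (λ x → S x ∧ H x y) _)

N⁺-─ : (H : BipGraph n b) (Y : Subsetᶠ b) (S : Subsetᶠ n) → N⁺ (H ─ Y) S ≗ N⁺ H S ∩ ∁ Y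
N⁺-─ H Y S y = trans (anyB-cong λ x → sym (∧-assoc (S x) (H x y) _))
                     (anyB-∧ʳ (λ x → S x ∧ H x y) _)

N⁺-flip-∁N⁺ : (H : BipGraph n b) (S : Subsetᶠ n) → N⁺ (flip H) (∁ (N⁺ H S)) ⊆ ∁ S
N⁺-flip-∁N⁺ H S t with N⁺-elim (flip H) (∁ (N⁺ H S)) t
... | y , y∉NS , adj = ¬T⇒T-not λ Sx → T-not⇒¬T y∉NS (N⁺-intro H S Sx adj)

card-N⁺-─ : (H : BipGraph n b) (Y : Subsetᶠ b) (S : Subsetᶠ n) →
            card (N⁺ H S) ≤ card (N⁺ (H ─ Y) S) + card Y
card-N⁺-─ H Y S = begin
  card (N⁺ H S)                    ≤⟨ card-mono (N⁺ H S) (N⁺ H S ∪ Y) (from T-∨ ∘ inj₁) ⟩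
  card (N⁺ H S ∪ Y)                ≡⟨ weight-∪ (N⁺ H S) Y _ ⟩
  card (N⁺ H S ∩ ∁ Y) + card Y     ≡⟨ cong (_+ card Y) (weight-cong _ (N⁺-─ H Y S)) ⟨
  card (N⁺ (H ─ Y) S) + card Y     ∎
  where open ≤-Reasoning

card-N⁺-∪ : (H : BipGraph n b) (R S : Subsetᶠ n) →
            card (N⁺ H (R ∪ S)) ≡ card (N⁺ (H ─ N⁺ H S) R) + card (N⁺ H S)
card-N⁺-∪ H R S = begin
  card (N⁺ H (R ∪ S))                              ≡⟨ weight-cong _ (N⁺-∪ H R S) ⟩
  card (N⁺ H R ∪ N⁺ H S)                           ≡⟨ weight-∪ (N⁺ H R) (N⁺ H S) _ ⟩
  card (N⁺ H R ∩ ∁ (N⁺ H S)) + card (N⁺ H S)       ≡⟨ cong (_+ card (N⁺ H S)) (weight-cong _ (N⁺-─ H (N⁺ H S) R)) ⟨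
  card (N⁺ (H ─ N⁺ H S) R) + card (N⁺ H S)         ∎
  where open ≡-Reasoning

HallCondition : BipGraph n b → (Fin n → ℕ) → Set
HallCondition H f = ∀ S → weight S f ≤ card (N⁺ H S)

Critical : BipGraph n b → (Fin n → ℕ) → Subsetᶠ n → Set
Critical {n} H f S = 0 < weight S f × weight S f < sumF n f × card (N⁺ H S) ≤ weight S f

critical? : (H : BipGraph n b) (f : Fin n → ℕ) → Decidable₁ (Critical H f)
critical? H f S = (0 <? weight S f) ×-dec (weight S f <? _) ×-dec (card (N⁺ H S) ≤? weight S f)

Critical-cong : {H : BipGraph n b} {f : Fin n → ℕ} {S R : Subsetᶠ n} →
                S ≗ R → Critical H f S → Critical H f R
Critical-cong {H = H} {f} S≗R (pos , <sum , tight) =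
  subst (0 <_) w≡ pos , subst (_< _) w≡ <sum , subst₂ _≤_ (weight-cong _ (N⁺-cong H S≗R)) w≡ tight
  where
  w≡ = weight-cong f S≗R

hall-restrict : {H : BipGraph n b} {f : Fin n → ℕ} (S : Subsetᶠ n) →
                HallCondition H f → HallCondition H (restrict S f)
hall-restrict {H = H} {f} S hallH R = begin
  weight R (restrict S f)   ≡⟨ weight-restrict R S f ⟩
  weight (R ∩ S) f          ≤⟨ hallH (R ∩ S) ⟩
  card (N⁺ H (R ∩ S))       ≤⟨ card-mono (N⁺ H (R ∩ S)) (N⁺ H R) (N⁺-mono H (proj₁ ∘ to T-∧)) ⟩
  card (N⁺ H R)             ∎
  where open ≤-Reasoning

hall-contract : {H : BipGraph n b} {f : Fin n → ℕ} (S : Subsetᶠ n) →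
                HallCondition H f → card (N⁺ H S) ≤ weight S f →
                HallCondition (H ─ N⁺ H S) (restrict (∁ S) f)
hall-contract {H = H} {f} S hallH tight R = +-cancelʳ-≤ (weight S f) _ _ (begin
  weight R (restrict (∁ S) f) + weight S f        ≡⟨ cong (_+ weight S f) (weight-restrict R (∁ S) f) ⟩
  weight (R ∩ ∁ S) f + weight S f                 ≡⟨ weight-∪ R S f ⟨
  weight (R ∪ S) f                                ≤⟨ hallH (R ∪ S) ⟩
  card (N⁺ H (R ∪ S))                             ≡⟨ card-N⁺-∪ H R S ⟩
  card (N⁺ (H ─ N⁺ H S) R) + card (N⁺ H S)        ≤⟨ +-monoʳ-≤ _ tight ⟩
  card (N⁺ (H ─ N⁺ H S) R) + weight S f           ∎)
  where open ≤-Reasoning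

-- A set containing x₀ loses a unit of demand; any other set of positive demand misses
-- f(x₀) > 0, so it is proper, hence not critical, and has a neighbour to spare.
decrement-slack : {H : BipGraph n b} {f : Fin n → ℕ} {x₀ : Fin n} →
                  HallCondition H f → (∀ S → ¬ Critical H f S) → 0 < f x₀ → ∀ R →
                  weight R (decrement f x₀) ≡ 0 ⊎ weight R (decrement f x₀) < card (N⁺ H R)
decrement-slack {H = H} {f} {x₀} hallH noCritical pos R
  with R x₀ in Rx₀ | weight-decrement {f = f} {i = x₀} R pos
... | true  | w≡w′+1 = inj₂ (≤-trans (≤-reflexive (trans (+-comm 1 _) (sym w≡w′+1))) (hallH R))
... | false | w≡w′+0 with weight R f ≟ℕ 0
...   | yes w≡0 = inj₁ (trans (sym (+-identityʳ _)) (trans (sym w≡w′+0) w≡0))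
...   | no  w≢0 = inj₂ (subst (_< card (N⁺ H R)) (trans w≡w′+0 (+-identityʳ _)) w<card)
  where
  fx₀≤w∁ : f x₀ ≤ weight (∁ R) f
  fx₀≤w∁ = subst (λ r → (if not r then f x₀ else 0) ≤ weight (∁ R) f) Rx₀ (≤-sumF (restrict (∁ R) f) x₀)

  w<card : weight R f < card (N⁺ H R)
  w<card = ≰⇒> λ card≤w → noCritical R (n≢0⇒n>0 w≢0 , weight<sumF f (<-≤-trans pos fx₀≤w∁) , card≤w)

hall-assign : {H : BipGraph n b} {f : Fin n → ℕ} {x₀ : Fin n} (y : Fin b) →
              HallCondition H f → (∀ S → ¬ Critical H f S) → 0 < f x₀ →
              HallCondition (H ─ ⁅ y ⁆) (decrement f x₀)
hall-assign {H = H} {f} {x₀} y hallH noCritical pos R with decrement-slack {H = H} hallH noCritical pos R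
... | inj₁ w′≡0 = subst (_≤ _) (sym w′≡0) z≤n
... | inj₂ w′<card = +-cancelʳ-≤ 1 _ _ (begin
  weight R (decrement f x₀) + 1           ≡⟨ +-comm _ 1 ⟩
  suc (weight R (decrement f x₀))         ≤⟨ w′<card ⟩
  card (N⁺ H R)                           ≤⟨ card-N⁺-─ H ⁅ y ⁆ R ⟩
  card (N⁺ (H ─ ⁅ y ⁆) R) + card ⁅ y ⁆    ≡⟨ cong (card (N⁺ (H ─ ⁅ y ⁆) R) +_) (weight-⁅⁆ y _) ⟩
  card (N⁺ (H ─ ⁅ y ⁆) R) + 1             ∎)
  where open ≤-Reasoning

record Matching (H : BipGraph n b) (f : Fin n → ℕ) : Set where
  field
    X        : Fin n → Subsetᶠ b
    X⊆N      : ∀ {x y} → T (X x y) → Adj H x y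
    card-X   : ∀ x → card (X x) ≡ f x
    disjoint : ∀ {x x′ y} → x ≢ x′ → T (X x y) → T (X x′ y) → ⊥

emptyMatching : {H : BipGraph n b} {f : Fin n → ℕ} → (∀ x → f x ≡ 0) → Matching H f
emptyMatching {b = b} f≡0 = record
  { X        = λ _ _ → false
  ; X⊆N      = λ ()
  ; card-X   = λ x → trans (sumF-zero {b} λ _ → refl) (sym (f≡0 x))
  ; disjoint = λ _ ()
  }

glue : {H : BipGraph n b} {f : Fin n → ℕ} (S : Subsetᶠ n) →
       Matching H (restrict S f) → Matching (H ─ N⁺ H S) (restrict (∁ S) f) → Matching H f
glue {n} {b} {H} {f} S M₁ M₂ = record { X = X ; X⊆N = X⊆N ; card-X = card-X ; disjoint = disjoint }
  where
  module M₁ = Matching M₁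
  module M₂ = Matching M₂

  X : Fin n → Subsetᶠ b
  X x y = if S x then M₁.X x y else M₂.X x y

  X⊆N : ∀ {x y} → T (if S x then M₁.X x y else M₂.X x y) → Adj H x y
  X⊆N {x} t with S x
  ... | true  = M₁.X⊆N t
  ... | false = proj₁ (to T-∧ (M₂.X⊆N t))

  card-X : ∀ x → card (λ y → if S x then M₁.X x y else M₂.X x y) ≡ f x
  card-X x with S x | M₁.card-X x | M₂.card-X x
  ... | true  | card₁ | _     = card₁
  ... | false | _     | card₂ = card₂

  separated : ∀ {x x′ y} → T (S x) → T (M₁.X x y) → ¬ T (M₂.X x′ y)
  separated {x} {x′} {y} Sx t₁ t₂ =
    T-not⇒¬T (proj₂ (to T-∧ (M₂.X⊆N t₂))) (N⁺-intro H S Sx (M₁.X⊆N t₁))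

  disjoint : ∀ {x x′ y} → x ≢ x′ → T (if S x then M₁.X x y else M₂.X x y) →
             T (if S x′ then M₁.X x′ y else M₂.X x′ y) → ⊥
  disjoint {x} {x′} x≢x′ t t′ with S x in Sx | S x′ in Sx′
  ... | true  | true  = M₁.disjoint x≢x′ t t′
  ... | false | false = M₂.disjoint x≢x′ t t′
  ... | true  | false = separated (from T-≡ Sx) t t′
  ... | false | true  = separated (from T-≡ Sx′) t′ t

assign : {H : BipGraph n b} {f : Fin n → ℕ} {x₀ : Fin n} {y₀ : Fin b} →
          Adj H x₀ y₀ → 0 < f x₀ → Matching (H ─ ⁅ y₀ ⁆) (decrement f x₀) → Matching H f
assign {n} {b} {H} {f} {x₀} {y₀} adj pos M = record { X = X ; X⊆N = X⊆N ; card-X = card-X ; disjoint = disjoint }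
  where
  module M = Matching M

  edge : Fin n → Subsetᶠ b
  edge x y = ⁅ x₀ ⁆ x ∧ ⁅ y₀ ⁆ y

  X : Fin n → Subsetᶠ b
  X x = M.X x ∪ edge x

  avoids : ∀ {x y} → T (M.X x y) → ¬ T (⁅ y₀ ⁆ y)
  avoids t = T-not⇒¬T (proj₂ (to T-∧ (M.X⊆N t)))

  X⊆N : ∀ {x y} → T (X x y) → Adj H x y
  X⊆N t with to T-∨ t
  ... | inj₁ t′ = proj₁ (to T-∧ (M.X⊆N t′))
  ... | inj₂ e with to T-∧ e
  ...   | x≡x₀ , y≡y₀ = subst₂ (Adj H) (sym (⁅⁆-sound x≡x₀)) (sym (⁅⁆-sound y≡y₀)) adj

  card-edge : ∀ x → card (λ y → ⁅ x₀ ⁆ x ∧ ⁅ y₀ ⁆ y) ≡ unit x₀ x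
  card-edge x with ⁅ x₀ ⁆ x
  ... | true  = weight-⁅⁆ y₀ _
  ... | false = sumF-zero {b} λ _ → refl

  card-X : ∀ x → card (X x) ≡ f x
  card-X x = begin
    card (M.X x ∪ edge x)               ≡⟨ card-∪-disjoint (M.X x) (edge x) (λ t → avoids t ∘ proj₂ ∘ to T-∧) ⟩
    card (M.X x) + card (edge x)        ≡⟨ cong₂ _+_ (M.card-X x) (card-edge x) ⟩
    decrement f x₀ x + unit x₀ x        ≡⟨ m∸n+n≡m (unit≤ pos x) ⟩
    f x                                 ∎
    where open ≡-Reasoning

  disjoint : ∀ {x x′ y} → x ≢ x′ → T (X x y) → T (X x′ y) → ⊥
  disjoint x≢x′ t t′ with to T-∨ t | to T-∨ t′
  ... | inj₁ u | inj₁ u′ = M.disjoint x≢x′ u u′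
  ... | inj₁ u | inj₂ e′ = avoids u (proj₂ (to T-∧ e′))
  ... | inj₂ e | inj₁ u′ = avoids u′ (proj₂ (to T-∧ e))
  ... | inj₂ e | inj₂ e′ = x≢x′ (trans (⁅⁆-sound (proj₁ (to T-∧ e))) (sym (⁅⁆-sound (proj₁ (to T-∧ e′)))))

neighbour : {H : BipGraph n b} {f : Fin n → ℕ} {x₀ : Fin n} →
            HallCondition H f → 0 < f x₀ → ∃ λ y → Adj H x₀ y
neighbour {H = H} {f} {x₀} hallH pos
  with card-pos {S = N⁺ H ⁅ x₀ ⁆} (<-≤-trans pos (subst (_≤ _) (weight-⁅⁆ x₀ f) (hallH ⁅ x₀ ⁆)))
... | y , y∈N with N⁺-elim H ⁅ x₀ ⁆ y∈N
...   | x , x≡x₀ , adj = y , subst (λ x → Adj H x y) (⁅⁆-sound x≡x₀) adj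

hall : ∀ w {H : BipGraph n b} {f : Fin n → ℕ} → sumF n f < w → HallCondition H f → Matching H f
hall {n} (suc w) {H} {f} f<w hallH with any? (λ x → 0 <? f x)
... | no noPositive = emptyMatching λ x → n<1⇒n≡0 (≰⇒> λ pos → noPositive (x , pos))
... | yes (x₀ , pos) with anySubset? (critical? H f ∘ lookup)
...   | yes (U , wS>0 , wS<sum , tight) =
        glue (lookup U)
          (hall w {H} (<-≤-trans wS<sum (≤-pred f<w))
                      (hall-restrict {H = H} (lookup U) hallH))
          (hall w {H ─ N⁺ H (lookup U)} (<-≤-trans (weight-∁<sumF f wS>0) (≤-pred f<w))
                                        (hall-contract {H = H} (lookup U) hallH tight))
...   | no noCritical with neighbour {H = H} hallH pos
...     | y₀ , adj = assign adj pos (hall w {H ─ ⁅ y₀ ⁆} (<-≤-trans decrement< (≤-pred f<w))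
                                        (hall-assign y₀ hallH noCritical′ pos))
  where
  noCritical′ : ∀ S → ¬ Critical H f S
  noCritical′ S critical = noCritical (tabulate S , Critical-cong {H = H} (sym ∘ lookup∘tabulate S) critical)

  decrement< : sumF n (decrement f x₀) < sumF n f
  decrement< = ≤-reflexive (trans (+-comm 1 _) (sym (weight-decrement {f = f} (λ _ → true) pos)))

hall-large : {f : Fin n → ℕ} {H : BipGraph n (sumF n f)} (m : ℕ) → (∀ x → 1 ≤ f x) →
             (∀ V → card V ≤ m → card V ≤ card (N⁺ (flip H) V)) →
             (∀ S V → m ≤ card S → m ≤ card V → ∃₂ λ x y → T (S x) × T (V y) × Adj H x y) →
             ∀ S → m ≤ card S → weight S f ≤ card (N⁺ H S)
hall-large {n} {f} {H} m f≥1 expandB connected S large = +-cancelʳ-≤ (card V) _ _ (begin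
  weight S f + card V           ≤⟨ +-monoʳ-≤ (weight S f) V≤w∁S ⟩
  weight S f + weight (∁ S) f   ≡⟨ weight-∁ S f ⟩
  sumF n f                      ≡⟨ card-∁ (N⁺ H S) ⟨
  card (N⁺ H S) + card V        ∎)
  where
  open ≤-Reasoning
  V : Subsetᶠ (sumF n f)
  V = ∁ (N⁺ H S)

  V-small : card V ≤ m
  V-small with m ≤? card V
  ... | no  m≰V = <⇒≤ (≰⇒> m≰V)
  ... | yes m≤V with connected S V large m≤V
  ...   | x , y , Sx , Vy , adj = contradiction (N⁺-intro H S Sx adj) (T-not⇒¬T Vy)

  V≤w∁S : card V ≤ weight (∁ S) f
  V≤w∁S = begin
    card V                  ≤⟨ expandB V V-small ⟩
    card (N⁺ (flip H) V)    ≤⟨ card-mono (N⁺ (flip H) V) (∁ S) (N⁺-flip-∁N⁺ H S) ⟩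
    card (∁ S)              ≤⟨ weight-monoʳ (∁ S) f≥1 ⟩
    weight (∁ S) f          ∎

hall-of-expansion : {f : Fin n → ℕ} {H : BipGraph n (sumF n f)} (m Δ : ℕ) →
                    (∀ x → 1 ≤ f x × f x ≤ Δ) →
                    (∀ S → card S ≤ m → Δ * card S ≤ card (N⁺ H S)) →
                    (∀ V → card V ≤ m → card V ≤ card (N⁺ (flip H) V)) →
                    (∀ S V → m ≤ card S → m ≤ card V → ∃₂ λ x y → T (S x) × T (V y) × Adj H x y) →
                    HallCondition H f
hall-of-expansion {f = f} {H} m Δ bounds expandA expandB connected S with ≤-total (card S) m
... | inj₁ small = begin
  weight S f             ≤⟨ weight-monoʳ S (proj₂ ∘ bounds) ⟩
  weight S (λ _ → Δ)     ≡⟨ weight-const S Δ ⟩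
  Δ * card S             ≤⟨ expandA S small ⟩
  card (N⁺ H S)          ∎
  where open ≤-Reasoning
... | inj₂ large = hall-large m (proj₁ ∘ bounds) expandB connected S large

∈-tabulate⁻ : {S : Subsetᶠ k} {i : Fin k} → i ∈ tabulate S → T (S i)
∈-tabulate⁻ {S = S} {i} i∈ = from T-≡ (trans (sym (lookup∘tabulate S i)) ([]=⇒lookup i∈))

∣p∣≡card : (p : Subset k) → ∣ p ∣ ≡ card (lookup p)
∣p∣≡card []          = refl
∣p∣≡card (true ∷ p)  = cong suc (∣p∣≡card p)
∣p∣≡card (false ∷ p) = ∣p∣≡card p

∣tabulate∣ : (S : Subsetᶠ k) → ∣ tabulate S ∣ ≡ card S
∣tabulate∣ S = trans (∣p∣≡card (tabulate S)) (weight-cong _ (lookup∘tabulate S))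

∣NA-tabulate∣ : (H : BipGraph n b) (S : Subsetᶠ n) → ∣ NA H (tabulate S) ∣ ≡ card (N⁺ H S)
∣NA-tabulate∣ H S = trans (∣tabulate∣ (N⁺ H (lookup (tabulate S))))
                          (weight-cong _ (N⁺-cong H (lookup∘tabulate S)))

toFMatching : {H : BipGraph n b} {f : Fin n → ℕ} → Matching H f → FMatching H f
toFMatching M = record
  { X        = tabulate ∘ X
  ; inNbhd   = λ _ _ → X⊆N ∘ ∈-tabulate⁻
  ; size     = λ x → trans (∣tabulate∣ (X x)) (card-X x)
  ; disjoint = λ _ _ _ x≢x′ y∈ y∈′ → disjoint x≢x′ (∈-tabulate⁻ y∈) (∈-tabulate⁻ y∈′)
  }
  where open Matching M

expansionᶠ : (G : BipGraph n b) (g : ℕ → ℕ) (m : ℕ) →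
             (∀ U → ∣ U ∣ ≤ m → g ∣ U ∣ ≤ ∣ NA G U ∣) →
             ∀ S → card S ≤ m → g (card S) ≤ card (N⁺ G S)
expansionᶠ G g m expand S small = subst₂ (λ u v → g u ≤ v) (∣tabulate∣ S) (∣NA-tabulate∣ G S)
  (expand (tabulate S) (subst (_≤ m) (sym (∣tabulate∣ S)) small))

lemma3p34 : (n m Δ : ℕ) (f : Fin n → ℕ) →
    (∀ i → 1 ≤ f i × f i ≤ Δ) →
    (H : BipGraph n (sumF n f)) →
    (∀ (U : Subset n) → ∣ U ∣ ≤ m → Δ * ∣ U ∣ ≤ ∣ NA H U ∣) →
    (∀ (V : Subset (sumF n f)) → ∣ V ∣ ≤ m → ∣ V ∣ ≤ ∣ NB H V ∣) →
    (∀ (U : Subset n) (V : Subset (sumF n f)) → m ≤ ∣ U ∣ → m ≤ ∣ V ∣ →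
      ∃₂ λ x y → x ∈ U × y ∈ V × Adj H x y) →
    FMatching H f
lemma3p34 n m Δ f bounds H expandA expandB connected =
  toFMatching (hall (suc (sumF n f)) ≤-refl hallH)
  where
  connectedᶠ : ∀ S V → m ≤ card S → m ≤ card V → ∃₂ λ x y → T (S x) × T (V y) × Adj H x y
  connectedᶠ S V m≤S m≤V
    with connected (tabulate S) (tabulate V) (subst (m ≤_) (sym (∣tabulate∣ S)) m≤S)
                                             (subst (m ≤_) (sym (∣tabulate∣ V)) m≤V)
  ... | x , y , x∈U , y∈V , adj = x , y , ∈-tabulate⁻ x∈U , ∈-tabulate⁻ y∈V , adj

  hallH : HallCondition H f
  hallH = hall-of-expansion m Δ bounds (expansionᶠ H (Δ *_) m expandA)
                                       -- NB H is NA (flip H) by definition.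
                                       (expansionᶠ (flip H) id m expandB) connectedᶠ
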